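{- Consider any allocation process satisfying $\mathcal{P}_1$ and $\mathcal{W}_1$. For every integer $t_0\ge1$, there are (deterministically) at least $n/40$ rounds $t\in[t_0,t_0+n]$ such that $\Delta^t\ge n/10$ or $|B_-^t|\ge n/20$.
   Context: There are $n$ bins; $x^t$ is the load vector after round $t$, $W^t=\sum_ix_i^t$, $y_i^t=x_i^t-W^t/n$, $\Delta^t=\sum_i|y_i^t|$, $B_-^t=\{i:y_i^t<0\}$. $\mathcal{P}_1$: in round $t$, with bins labeled so that $y_1^t\ge\dots\ge y_n^t$, a bin $i$ is sampled according to a distribution $p^t$ (possibly depending on the history) with $\sum_{j\le k}p_j^t\le k/n$ for all $k$. $\mathcal{W}_1$: if $y_i^t<0$, exactly $\lceil-y_i^t\rceil+1$ balls are allocated (possibly to other bins) such that at most one bin $k_1$ receives $\lceil-y_{k_1}^t\rceil+1$ balls, at most one bin $k_2$ receives $\lceil-y_{k_2}^t\rceil$ balls, and every other bin $j$ receives at most $\lceil-y_j^t\rceil-1$ balls; if $y_i^t\ge0$, one ball is placed into $i$. -}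

module Defs where

open import Data.Nat as ℕ using (ℕ; zero; suc; NonZero)
open import Data.Integer as ℤ using (ℤ; +_; _/ℕ_; ∣_∣)
open import Data.Fin using (Fin)
open import Data.Fin.Properties using (_≟_)
open import Data.List using (List; length; filter; upTo; map)
open import Data.List.Base using (sum)
open import Data.Vec.Functional using (Vector)
open import Data.Product using (Σ; ∃; ∃₂; _×_; _,_)
open import Data.Sum using (_⊎_)
open import Relation.Binary.PropositionalEquality using (_≡_)
open import Relation.Nullary using (Dec; yes; no; ¬_)
open import Relation.Nullary.Decidable using (_⊎-dec_)

Load : ℕ → Set
Load n = Fin n → ℕ

sumFin : ∀ {n} → (Fin n → ℕ) → ℕ
sumFin {zero}  f = 0
sumFin {suc n} f = f Fin.zero ℕ.+ sumFin (λ i → f (Fin.suc i))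
  where import Data.Fin as Fin

sumFinℤ : ∀ {n} → (Fin n → ℤ) → ℤ
sumFinℤ {zero}  f = + 0
sumFinℤ {suc n} f = f Fin.zero ℤ.+ sumFinℤ (λ i → f (Fin.suc i))
  where import Data.Fin as Fin

W : ∀ {n} → Load n → ℕ
W x = sumFin x

-- n · y_i = n · x_i − W   (y_i = x_i − W/n scaled by n, so it is an integer).
ny : ∀ {n} → Load n → Fin n → ℤ
ny {n} x i = + (n ℕ.* x i) ℤ.- + W x

nΔ : ∀ {n} → Load n → ℕ
nΔ x = sumFin (λ i → ∣ ny x i ∣)

InBminus : ∀ {n} → Load n → Fin n → Set
InBminus x i = ny x i ℤ.< + 0

inBminus? : ∀ {n} (x : Load n) (i : Fin n) → Dec (InBminus x i)
inBminus? x i = ny x i ℤ.<? + 0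

card-Bminus : ∀ {n} → Load n → ℕ
card-Bminus {n} x = length (filter (inBminus? x) (Data.List.allFin n))
  where import Data.List

-- ⌈ −y_i ⌉ = ⌈ (W − n x_i) / n ⌉, computed as −⌊ (n x_i − W) / n ⌋ (floor division).
ceilNegY : ∀ {n} .{{_ : NonZero n}} → Load n → Fin n → ℤ
ceilNegY {n} x i = ℤ.- (ny x i /ℕ n)

W₁-step : ∀ {n} .{{_ : NonZero n}} → Load n → Fin n → Load n → Set
W₁-step {n} x i x′ =
  (InBminus x i →
     Σ (Fin n → ℕ) λ r →
       (∀ j → x′ j ≡ x j ℕ.+ r j)
     × (+ sumFin r ≡ ceilNegY x i ℤ.+ + 1)
     × ∃₂ λ k₁ k₂ →
         (+ r k₁ ℤ.≤ ceilNegY x k₁ ℤ.+ + 1)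
       × (+ r k₂ ℤ.≤ ceilNegY x k₂)
       × (∀ j → ¬ j ≡ k₁ → ¬ j ≡ k₂ →
            r j ≡ 0 ⊎ + r j ℤ.≤ ceilNegY x j ℤ.- + 1))
  × (¬ InBminus x i →
       (x′ i ≡ suc (x i)) × (∀ j → ¬ j ≡ i → x′ j ≡ x j))

-- A run of an allocation process satisfying P₁ and W₁: starting from empty
-- bins, in every round t+1 some bin i (the sampled bin) is processed by W₁.
-- (Under P₁ with e.g. the uniform distribution every bin can be sampled, so
-- "deterministically for every process satisfying P₁" ranges over all
-- choices of sampled bins.)
IsRun : ∀ {n} .{{_ : NonZero n}} → (ℕ → Load n) → Set
IsRun {n} x =
  (∀ i → x 0 i ≡ 0) × (∀ t → ∃ λ (i : Fin n) → W₁-step (x t) i (x (suc t)))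

-- Round t is "good": Δ^t ≥ n/10 or |B_-^t| ≥ n/20, i.e.
-- 10 · (n·Δ^t) ≥ n·n  or  20 · |B_-^t| ≥ n.
Good : ∀ {n} → Load n → Set
Good {n} x = (n ℕ.* n ℕ.≤ 10 ℕ.* nΔ x) ⊎ (n ℕ.≤ 20 ℕ.* card-Bminus x)

good? : ∀ {n} (x : Load n) → Dec (Good x)
good? {n} x = (n ℕ.* n ℕ.≤? 10 ℕ.* nΔ x) ⊎-dec (n ℕ.≤? 20 ℕ.* card-Bminus x)

countGood : ∀ {n} → (ℕ → Load n) → ℕ → ℕ
countGood {n} x t₀ =
  length (filter (λ t → good? (x t)) (map (t₀ ℕ.+_) (upTo (suc n))))

{-# OPTIONS --safe #-}
-- In a round that is not good Δ < n/10, so the load ℓ of the bin closest to the average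
-- satisfies |W − nℓ| < n/10 and the deficit Σⱼ (ℓ − xⱼ)⁺ is below n/5.  A round whose total W
-- lies strictly between nℓ + n/10 and n(ℓ+1) − n/10 cannot be bad for any level, so it is good.
-- Since W grows by at least one ball per round, W stays below nℓ + n/10 for fewer than n/5
-- rounds after a bad round at level ℓ.  While W ≤ n(ℓ+1) we have ⌈−yⱼ⌉ + xⱼ ≤ ℓ + 1, so under
-- W₁ every bin other than k₁ and k₂ stays at most ℓ, and Σⱼ max(xⱼ, ℓ) grows by at most 3 per
-- round; hence W needs more than n/5 rounds to cross from below nℓ + n/10 to above
-- n(ℓ+1) − n/10, and all these rounds are good.  Taking ℓ from the first bad round of the
-- window, either this crossing happens inside the window, or all bad rounds of the window lie
-- in fewer than n/5 consecutive rounds, leaving a long good stretch before or after them.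
module Submission where

open import Defs
open import Data.Empty using (⊥)
open import Data.Fin.Base using (Fin; zero; suc)
open import Data.Fin.Properties using () renaming (_≟_ to _≟ᶠ_)
open import Data.Integer.Base as ℤ using (ℤ; _/ℕ_)
open import Data.Integer.DivMod using (n<s[n/ℕd]*d; [n/ℕd]*d≤n)
import Data.Integer.Properties as ℤP
import Data.Integer.Tactic.RingSolver as ℤSolver
open import Data.List.Base using ([]; _∷_; applyUpTo; filter; length; allFin)
open import Data.List.Extrema.Nat using (argmin; f[argmin]≤f[xs])
open import Data.List.Membership.Propositional.Properties using (∈-allFin)
open import Data.List.Properties using (map-upTo)
import Data.List.Relation.Unary.All as All
open import Data.Nat.Base
open import Data.Nat.Properties
open import Data.Nat.Tactic.RingSolver using (solve)
open import Data.Product.Base using (∃; _×_; _,_; proj₁; proj₂)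
open import Data.Sum.Base as Sum using (_⊎_; inj₁; inj₂)
open import Function.Base using (_∘_)
open import Relation.Binary.PropositionalEquality
open import Relation.Nullary.Decidable using (Dec; yes; no; ¬?; decidable-stable)
open import Relation.Nullary.Negation using (¬_; contradiction)
open import Relation.Unary using (Pred; Decidable)

open import Algebra.Properties.Semiring.Sum +-*-semiring
  using (sum; sum-cong-≗; sum-replicate-zero; ∑-distrib-+; *-distribˡ-sum)

sumFin≡sum : ∀ {n} (f : Fin n → ℕ) → sumFin f ≡ sum f
sumFin≡sum {zero}  f = refl
sumFin≡sum {suc n} f = cong (f zero +_) (sumFin≡sum (f ∘ suc))

sumFin-cong : ∀ {n} {f g : Fin n → ℕ} → f ≗ g → sumFin f ≡ sumFin g
sumFin-cong {f = f} {g} f≗g = begin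
  sumFin f ≡⟨ sumFin≡sum f ⟩
  sum f    ≡⟨ sum-cong-≗ f≗g ⟩
  sum g    ≡⟨ sumFin≡sum g ⟨
  sumFin g ∎
  where open ≡-Reasoning

sumFin-+ : ∀ {n} (f g : Fin n → ℕ) → sumFin (λ j → f j + g j) ≡ sumFin f + sumFin g
sumFin-+ f g = begin
  sumFin (λ j → f j + g j) ≡⟨ sumFin≡sum (λ j → f j + g j) ⟩
  sum (λ j → f j + g j)    ≡⟨ ∑-distrib-+ f g ⟩
  sum f + sum g            ≡⟨ cong₂ _+_ (sumFin≡sum f) (sumFin≡sum g) ⟨
  sumFin f + sumFin g      ∎
  where open ≡-Reasoning

*-distribˡ-sumFin : ∀ {n} c (f : Fin n → ℕ) → c * sumFin f ≡ sumFin (λ j → c * f j)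
*-distribˡ-sumFin c f = begin
  c * sumFin f           ≡⟨ cong (c *_) (sumFin≡sum f) ⟩
  c * sum f              ≡⟨ *-distribˡ-sum c f ⟩
  sum (λ j → c * f j)    ≡⟨ sumFin≡sum (λ j → c * f j) ⟨
  sumFin (λ j → c * f j) ∎
  where open ≡-Reasoning

sumFin-mono : ∀ {n} {f g : Fin n → ℕ} → (∀ j → f j ≤ g j) → sumFin f ≤ sumFin g
sumFin-mono {zero}  f≤g = z≤n
sumFin-mono {suc n} f≤g = +-mono-≤ (f≤g zero) (sumFin-mono (f≤g ∘ suc))

≤-sumFin : ∀ {n} (f : Fin n → ℕ) j → f j ≤ sumFin f
≤-sumFin f zero    = m≤m+n _ _
≤-sumFin f (suc j) = ≤-trans (≤-sumFin (f ∘ suc) j) (m≤n+m _ _)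

*-≤-sumFin : ∀ {n c} {f : Fin n → ℕ} → (∀ j → c ≤ f j) → n * c ≤ sumFin f
*-≤-sumFin {zero}  c≤f = z≤n
*-≤-sumFin {suc n} c≤f = +-mono-≤ (c≤f zero) (*-≤-sumFin (c≤f ∘ suc))

pointMass : ∀ {n} → Fin n → ℕ → Fin n → ℕ
pointMass zero    v zero    = v
pointMass zero    v (suc j) = 0
pointMass (suc k) v zero    = 0
pointMass (suc k) v (suc j) = pointMass k v j

pointMass-self : ∀ {n} (k : Fin n) v → pointMass k v k ≡ v
pointMass-self zero    v = refl
pointMass-self (suc k) v = pointMass-self k v

pointMass-other : ∀ {n} {j k : Fin n} v → j ≢ k → pointMass k v j ≡ 0
pointMass-other {j = zero}  {zero}  v j≢k = contradiction refl j≢k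
pointMass-other {j = zero}  {suc k} v j≢k = refl
pointMass-other {j = suc j} {zero}  v j≢k = refl
pointMass-other {j = suc j} {suc k} v j≢k = pointMass-other v (j≢k ∘ cong suc)

sumFin-pointMass : ∀ {n} (k : Fin n) v → sumFin (pointMass k v) ≡ v
sumFin-pointMass {suc n} zero    v = begin
  v + sumFin {n} (λ _ → 0) ≡⟨ cong (v +_) (trans (sumFin≡sum {n} (λ _ → 0)) (sum-replicate-zero n)) ⟩
  v + 0                    ≡⟨ +-identityʳ v ⟩
  v                        ∎
  where open ≡-Reasoning
sumFin-pointMass {suc n} (suc k) v = sumFin-pointMass k v

-- Deficit and potential of a level ℓ

m+[n∸m]≡m⊔n : ∀ m n → m + (n ∸ m) ≡ m ⊔ n
m+[n∸m]≡m⊔n m n with ≤-total m n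
... | inj₁ m≤n = trans (m+[n∸m]≡n m≤n) (sym (m≤n⇒m⊔n≡n m≤n))
... | inj₂ n≤m = begin
  m + (n ∸ m) ≡⟨ cong (m +_) (m≤n⇒m∸n≡0 n≤m) ⟩
  m + 0       ≡⟨ +-identityʳ m ⟩
  m           ≡⟨ m≥n⇒m⊔n≡m n≤m ⟨
  m ⊔ n       ∎
  where open ≡-Reasoning

deficit : ∀ {n} → ℕ → Load n → ℕ
deficit ℓ x = sumFin (λ j → ℓ ∸ x j)

potential : ∀ {n} → ℕ → Load n → ℕ
potential ℓ x = sumFin (λ j → x j ⊔ ℓ)

potential≡W+deficit : ∀ {n} ℓ (x : Load n) → potential ℓ x ≡ W x + deficit ℓ x
potential≡W+deficit ℓ x = begin
  sumFin (λ j → x j ⊔ ℓ)         ≡⟨ sumFin-cong (λ j → m+[n∸m]≡m⊔n (x j) ℓ) ⟨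
  sumFin (λ j → x j + (ℓ ∸ x j)) ≡⟨ sumFin-+ x (λ j → ℓ ∸ x j) ⟩
  W x + deficit ℓ x              ∎
  where open ≡-Reasoning

W≤potential : ∀ {n} ℓ (x : Load n) → W x ≤ potential ℓ x
W≤potential ℓ x = sumFin-mono (λ j → m≤m⊔n (x j) ℓ)

deficit≡0⇒level≤ : ∀ {n ℓ} (x : Load n) → deficit ℓ x ≡ 0 → ∀ j → ℓ ≤ x j
deficit≡0⇒level≤ {ℓ = ℓ} x deficit≡0 j =
  m∸n≡0⇒m≤n (n≤0⇒n≡0 (≤-trans (≤-sumFin (λ i → ℓ ∸ x i) j) (≤-reflexive deficit≡0)))

potential-increment : ∀ {n ℓ} {x x′ e : Load n} → (∀ j → x′ j ≤ (x j ⊔ ℓ) + e j) →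
                      potential ℓ x′ ≤ potential ℓ x + sumFin e
potential-increment {ℓ = ℓ} {x} {x′} {e} x′≤ = begin
  potential ℓ x′                 ≤⟨ sumFin-mono (λ j → ⊔-lub (x′≤ j) (≤-trans (m≤n⊔m (x j) ℓ) (m≤m+n _ (e j)))) ⟩
  sumFin (λ j → (x j ⊔ ℓ) + e j) ≡⟨ sumFin-+ (λ j → x j ⊔ ℓ) e ⟩
  potential ℓ x + sumFin e       ∎
  where open ≤-Reasoning

W-increment : ∀ {n} {x x′ r : Load n} → (∀ j → x′ j ≡ x j + r j) → W x′ ≡ W x + sumFin r
W-increment {x = x} {r = r} x′≡x+r = trans (sumFin-cong x′≡x+r) (sumFin-+ x r)

W₁-excess : ∀ {n} → Fin n → Fin n → Fin n → ℕ
W₁-excess k₁ k₂ j = pointMass k₁ 2 j + pointMass k₂ 1 j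

sumFin-W₁-excess : ∀ {n} (k₁ k₂ : Fin n) → sumFin (W₁-excess k₁ k₂) ≡ 3
sumFin-W₁-excess k₁ k₂ =
  trans (sumFin-+ (pointMass k₁ 2) (pointMass k₂ 1)) (cong₂ _+_ (sumFin-pointMass k₁ 2) (sumFin-pointMass k₂ 1))

-- The ceilings ⌈−yⱼ⌉ and the W₁ allocation bounds

distance : ∀ {n} → Load n → Fin n → ℕ
distance {n} x i = ∣ n * x i - W x ∣

module _ where
  open import Data.Integer.Base using (+_; _-_; -_)

  ∣+m-+n∣≡∣m-n∣ : ∀ m n → ℤ.∣ + m - + n ∣ ≡ ∣ m - n ∣
  ∣+m-+n∣≡∣m-n∣ m n rewrite ℤP.m-n≡m⊖n m n with ≤-total m n
  ... | inj₁ m≤n = trans (ℤP.∣⊖∣-≤ m≤n) (sym (m≤n⇒∣m-n∣≡n∸m m≤n))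
  ... | inj₂ n≤m = trans (cong ℤ.∣_∣ (ℤP.⊖-≥ n≤m)) (sym (m≤n⇒∣n-m∣≡n∸m n≤m))

  ≤-/ℕ : ∀ {a b : ℤ} {d} .{{_ : NonZero d}} → b ℤ.* + d ℤ.≤ a → b ℤ.≤ a /ℕ d
  ≤-/ℕ {a} {b} {d} b*d≤a = ℤP.≮⇒≥ λ a/d<b → ℤP.<-irrefl refl (ℤP.<-≤-trans (n<s[n/ℕd]*d a d)
    (ℤP.≤-trans (ℤP.*-monoʳ-≤-nonNeg (+ d) (ℤP.i<j⇒suc[i]≤j a/d<b)) b*d≤a))

  /ℕ-nonPos : ∀ {a : ℤ} {d} .{{_ : NonZero d}} → a ℤ.< + 0 → a /ℕ d ℤ.≤ + 0
  /ℕ-nonPos {a} {d} a<0 = ℤP.≮⇒≥ λ 0<a/d → ℤP.<-irrefl refl (ℤP.≤-<-trans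
    (ℤP.≤-trans (ℤP.*-monoʳ-≤-nonNeg (+ d) (ℤP.<⇒≤ 0<a/d)) ([n/ℕd]*d≤n a d)) a<0)

  nΔ≡sumFin-distance : ∀ {n} (x : Load n) → nΔ x ≡ sumFin (distance x)
  nΔ≡sumFin-distance {n} x = sumFin-cong (λ i → ∣+m-+n∣≡∣m-n∣ (n * x i) (W x))

  module _ {n} .{{_ : NonZero n}} {x : Load n} where

    ceilNegY-nonNeg : ∀ {i} → InBminus x i → + 0 ℤ.≤ ceilNegY x i
    ceilNegY-nonNeg i∈B = ℤP.neg-mono-≤ (/ℕ-nonPos i∈B)

    ¬InBminus : ∀ {i} → W x ≤ n * x i → ¬ InBminus x i
    ¬InBminus W≤nxᵢ = ℤP.≤⇒≯ (ℤP.i≤j⇒0≤j-i (ℤ.+≤+ W≤nxᵢ))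

    ceilNegY+xⱼ≤1+ℓ : ∀ {ℓ} → W x ≤ n * suc ℓ → ∀ j → ceilNegY x j ℤ.+ + x j ℤ.≤ + suc ℓ
    ceilNegY+xⱼ≤1+ℓ {ℓ} W≤ j = begin
      ceilNegY x j ℤ.+ + x j ≤⟨ ℤP.+-monoˡ-≤ (+ x j) (ℤP.neg-mono-≤ (≤-/ℕ {b = b} b*n≤ny)) ⟩
      - b ℤ.+ + x j          ≡⟨ -[i-j]+i≡j (+ x j) (+ suc ℓ) ⟩
      + suc ℓ                ∎
      where
      open ℤP.≤-Reasoning
      b = + x j - + suc ℓ
      -[i-j]+i≡j : ∀ i j → - (i - j) ℤ.+ i ≡ j
      -[i-j]+i≡j = ℤSolver.solve-∀
      [i-j]*k≡k*i-k*j : ∀ i j k → (i - j) ℤ.* k ≡ k ℤ.* i - k ℤ.* j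
      [i-j]*k≡k*i-k*j = ℤSolver.solve-∀
      b*n≤ny : b ℤ.* + n ℤ.≤ ny x j
      b*n≤ny = begin
        b ℤ.* + n                             ≡⟨ [i-j]*k≡k*i-k*j (+ x j) (+ suc ℓ) (+ n) ⟩
        + n ℤ.* + x j - + n ℤ.* + suc ℓ       ≡⟨ cong₂ _-_ (ℤP.pos-* n (x j)) (ℤP.pos-* n (suc ℓ)) ⟨
        + (n * x j) - + (n * suc ℓ)           ≤⟨ ℤP.+-monoʳ-≤ (+ (n * x j)) (ℤP.neg-mono-≤ (ℤ.+≤+ W≤)) ⟩
        + (n * x j) - + W x                   ∎

    module _ {x′ r : Load n} {ℓ} (W≤ : W x ≤ n * suc ℓ) (x′≡x+r : ∀ j → x′ j ≡ x j + r j) where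

      -- The offset o is +1, 0 or −1 for the three kinds of bins of W₁; the equation lets each
      -- case be discharged by computation.
      allocation-bound : ∀ {e} j {o} → + r j ℤ.≤ ceilNegY x j ℤ.+ o → o ℤ.+ + suc ℓ ≡ + (e + ℓ) →
                         x′ j ≤ e + ℓ
      allocation-bound {e} j {o} r≤ o+ℓ+1≡e+ℓ = ℤP.drop‿+≤+ (begin
        + x′ j                          ≡⟨ cong +_ (trans (x′≡x+r j) (+-comm (x j) (r j))) ⟩
        + (r j + x j)                   ≡⟨ ℤP.pos-+ (r j) (x j) ⟩
        + r j ℤ.+ + x j                 ≤⟨ ℤP.+-monoˡ-≤ (+ x j) r≤ ⟩
        ceilNegY x j ℤ.+ o ℤ.+ + x j    ≡⟨ cong (ℤ._+ + x j) (ℤP.+-comm (ceilNegY x j) o) ⟩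
        o ℤ.+ ceilNegY x j ℤ.+ + x j    ≡⟨ ℤP.+-assoc o (ceilNegY x j) (+ x j) ⟩
        o ℤ.+ (ceilNegY x j ℤ.+ + x j)  ≤⟨ ℤP.+-monoʳ-≤ o (ceilNegY+xⱼ≤1+ℓ W≤ j) ⟩
        o ℤ.+ + suc ℓ                   ≡⟨ o+ℓ+1≡e+ℓ ⟩
        + (e + ℓ)                       ∎)
        where open ℤP.≤-Reasoning

      within-excess : ∀ {j E} e → x′ j ≤ e + ℓ → e ≤ E → x′ j ≤ (x j ⊔ ℓ) + E
      within-excess {j} {E} e x′≤e+ℓ e≤E =
        ≤-trans x′≤e+ℓ (≤-trans (+-mono-≤ e≤E (m≤n⊔m (x j) ℓ)) (≤-reflexive (+-comm E (x j ⊔ ℓ))))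

      allocation-fits : ∀ {k₁ k₂} → + r k₁ ℤ.≤ ceilNegY x k₁ ℤ.+ + 1 → + r k₂ ℤ.≤ ceilNegY x k₂ →
                        (∀ j → ¬ j ≡ k₁ → ¬ j ≡ k₂ → r j ≡ 0 ⊎ + r j ℤ.≤ ceilNegY x j - + 1) →
                        ∀ j → x′ j ≤ (x j ⊔ ℓ) + W₁-excess k₁ k₂ j
      allocation-fits {k₁} {k₂} r₁≤ r₂≤ r-other≤ j with j ≟ᶠ k₁
      ... | yes refl = within-excess 2 (allocation-bound j r₁≤ refl)
                         (subst (_≤ W₁-excess k₁ k₂ j) (pointMass-self j 2) (m≤m+n _ _))
      ... | no j≢k₁ with j ≟ᶠ k₂
      ...   | yes refl = within-excess 1 (allocation-bound j (ℤP.≤-trans r₂≤ (ℤP.≤-reflexive (sym (ℤP.+-identityʳ _)))) refl)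
                           (subst (_≤ W₁-excess k₁ k₂ j) (pointMass-self j 1) (m≤n+m _ _))
      ...   | no j≢k₂ with r-other≤ j j≢k₁ j≢k₂
      ...     | inj₂ r≤ = within-excess 0 (allocation-bound j r≤ refl) z≤n
      ...     | inj₁ r≡0 = ≤-trans (≤-reflexive (trans (x′≡x+r j) (trans (cong (λ v → x j + v) r≡0) (+-identityʳ (x j)))))
                                   (≤-trans (m≤m⊔n (x j) ℓ) (m≤m+n (x j ⊔ ℓ) _))

module _ {n} .{{_ : NonZero n}} {x x′ : Load n} {i : Fin n} (step : W₁-step x i x′) where

  unloaded-step : ¬ InBminus x i → ∀ j → x′ j ≡ x j + pointMass i 1 j
  unloaded-step i∉B j with j ≟ᶠ i
  ... | yes refl = begin
    x′ i                   ≡⟨ proj₁ (proj₂ step i∉B) ⟩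
    suc (x i)              ≡⟨ +-comm 1 (x i) ⟩
    x i + 1                ≡⟨ cong (x i +_) (pointMass-self i 1) ⟨
    x i + pointMass i 1 i  ∎
    where open ≡-Reasoning
  ... | no j≢i = begin
    x′ j                   ≡⟨ proj₂ (proj₂ step i∉B) j j≢i ⟩
    x j                    ≡⟨ +-identityʳ (x j) ⟨
    x j + 0                ≡⟨ cong (x j +_) (pointMass-other 1 j≢i) ⟨
    x j + pointMass i 1 j  ∎
    where open ≡-Reasoning

  W₁-step-increment : ∃ λ r → (∀ j → x′ j ≡ x j + r j) × 1 ≤ sumFin r
  W₁-step-increment with inBminus? x i
  ... | no i∉B = pointMass i 1 , unloaded-step i∉B , ≤-reflexive (sym (sumFin-pointMass i 1))
  ... | yes i∈B with proj₁ step i∈B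
  ...   | r , x′≡x+r , Σr≡ , _ = r , x′≡x+r , ℤP.drop‿+≤+ (begin
          ℤ.+ 1                  ≤⟨ ℤP.+-monoˡ-≤ (ℤ.+ 1) (ceilNegY-nonNeg i∈B) ⟩
          ceilNegY x i ℤ.+ ℤ.+ 1 ≡⟨ Σr≡ ⟨
          ℤ.+ sumFin r           ∎)
    where open ℤP.≤-Reasoning

  W₁-step-W< : W x < W x′
  W₁-step-W< with r , x′≡x+r , 1≤Σr ← W₁-step-increment = begin-strict
    W x            <⟨ n<1+n (W x) ⟩
    suc (W x)      ≡⟨ +-comm 1 (W x) ⟩
    W x + 1        ≤⟨ +-monoʳ-≤ (W x) 1≤Σr ⟩
    W x + sumFin r ≡⟨ W-increment x′≡x+r ⟨
    W x′           ∎
    where open ≤-Reasoning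

  W₁-step-load-mono : ∀ j → x j ≤ x′ j
  W₁-step-load-mono j with r , x′≡x+r , _ ← W₁-step-increment =
    ≤-trans (m≤m+n (x j) (r j)) (≤-reflexive (sym (x′≡x+r j)))

  W₁-step-balanced : ∀ {ℓ} → (∀ j → ℓ ≤ x j) → W x ≤ n * ℓ → W x′ ≡ suc (W x)
  W₁-step-balanced ℓ≤x W≤nℓ = begin
    W x′                         ≡⟨ W-increment (unloaded-step i∉B) ⟩
    W x + sumFin (pointMass i 1) ≡⟨ cong (W x +_) (sumFin-pointMass i 1) ⟩
    W x + 1                      ≡⟨ +-comm (W x) 1 ⟩
    suc (W x)                    ∎
    where
    open ≡-Reasoning
    i∉B : ¬ InBminus x i
    i∉B = ¬InBminus (≤-trans W≤nℓ (*-monoʳ-≤ n (ℓ≤x i)))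

  W₁-step-potential : ∀ {ℓ} → W x ≤ n * suc ℓ → potential ℓ x′ ≤ potential ℓ x + 3
  W₁-step-potential {ℓ} W≤ with inBminus? x i
  ... | no i∉B = begin
    potential ℓ x′                         ≤⟨ potential-increment unloaded ⟩
    potential ℓ x + sumFin (pointMass i 1) ≡⟨ cong (potential ℓ x +_) (sumFin-pointMass i 1) ⟩
    potential ℓ x + 1                      ≤⟨ +-monoʳ-≤ (potential ℓ x) (s≤s z≤n) ⟩
    potential ℓ x + 3                      ∎
    where
    open ≤-Reasoning
    unloaded : ∀ j → x′ j ≤ (x j ⊔ ℓ) + pointMass i 1 j
    unloaded j = ≤-trans (≤-reflexive (unloaded-step i∉B j)) (+-monoˡ-≤ _ (m≤m⊔n (x j) ℓ))
  ... | yes i∈B with proj₁ step i∈B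
  ...   | r , x′≡x+r , _ , k₁ , k₂ , r₁≤ , r₂≤ , r-other≤ = begin
    potential ℓ x′                           ≤⟨ potential-increment (allocation-fits W≤ x′≡x+r r₁≤ r₂≤ r-other≤) ⟩
    potential ℓ x + sumFin (W₁-excess k₁ k₂) ≡⟨ cong (potential ℓ x +_) (sumFin-W₁-excess k₁ k₂) ⟩
    potential ℓ x + 3                        ∎
    where open ≤-Reasoning

-- Levels of the total load

-- w < nℓ + n/10 and w > nℓ − n/10, multiplied by 10.
BelowLevel AboveLevel : ℕ → ℕ → ℕ → Set
BelowLevel n ℓ w = 10 * w < 10 * (n * ℓ) + n
AboveLevel n ℓ w = 10 * (n * ℓ) < 10 * w + n

module _ {n : ℕ} where

  BelowLevel-monoˡ : ∀ {ℓ ℓ′ w} → ℓ ≤ ℓ′ → BelowLevel n ℓ w → BelowLevel n ℓ′ w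
  BelowLevel-monoˡ ℓ≤ℓ′ below = <-≤-trans below (+-monoˡ-≤ n (*-monoʳ-≤ 10 (*-monoʳ-≤ n ℓ≤ℓ′)))

  AboveLevel-antiˡ : ∀ {ℓ ℓ′ w} → ℓ ≤ ℓ′ → AboveLevel n ℓ′ w → AboveLevel n ℓ w
  AboveLevel-antiˡ ℓ≤ℓ′ above = ≤-<-trans (*-monoʳ-≤ 10 (*-monoʳ-≤ n ℓ≤ℓ′)) above

  BelowLevel-antiʳ : ∀ {ℓ w w′} → w ≤ w′ → BelowLevel n ℓ w′ → BelowLevel n ℓ w
  BelowLevel-antiʳ w≤w′ below = ≤-<-trans (*-monoʳ-≤ 10 w≤w′) below

  AboveLevel-monoʳ : ∀ {ℓ w w′} → w ≤ w′ → AboveLevel n ℓ w → AboveLevel n ℓ w′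
  AboveLevel-monoʳ w≤w′ above = <-≤-trans above (+-monoˡ-≤ n (*-monoʳ-≤ 10 w≤w′))

  BelowLevel⇒¬AboveLevel-suc : ∀ {ℓ w} → BelowLevel n ℓ w → ¬ AboveLevel n (suc ℓ) w
  BelowLevel⇒¬AboveLevel-suc {ℓ} {w} below above = <⇒≱ (+-cancelʳ-< _ (10 * n) (2 * n) (begin-strict
    10 * n + 10 * (n * ℓ) ≡⟨ solve (n ∷ ℓ ∷ []) ⟩
    10 * (n * suc ℓ)      <⟨ above ⟩
    10 * w + n            <⟨ +-monoˡ-< n below ⟩
    10 * (n * ℓ) + n + n  ≡⟨ solve (n ∷ ℓ ∷ []) ⟩
    2 * n + 10 * (n * ℓ)  ∎)) (*-monoˡ-≤ n (m≤m+n 2 8))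
    where open ≤-Reasoning

  ¬AboveLevel-suc⇒≤ : ∀ {ℓ w} → ¬ AboveLevel n (suc ℓ) w → w ≤ n * suc ℓ
  ¬AboveLevel-suc⇒≤ {w = w} ¬above = *-cancelˡ-≤ 10 (≤-trans (m≤m+n (10 * w) n) (≮⇒≥ ¬above))

  band-width : ∀ {ℓ w q} → AboveLevel n ℓ w → BelowLevel n ℓ (w + q) → 5 * q < n
  band-width {ℓ} {w} {q} above below = *-cancelˡ-< 2 (5 * q) n
    (+-cancelˡ-< (10 * w + 10 * (n * ℓ)) (2 * (5 * q)) (2 * n) (begin-strict
      10 * w + 10 * (n * ℓ) + 2 * (5 * q) ≡⟨ solve (n ∷ ℓ ∷ w ∷ q ∷ []) ⟩
      10 * (w + q) + 10 * (n * ℓ)         <⟨ +-mono-< below above ⟩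
      10 * (n * ℓ) + n + (10 * w + n)     ≡⟨ solve (n ∷ ℓ ∷ w ∷ []) ⟩
      10 * w + 10 * (n * ℓ) + 2 * n       ∎))
    where open ≤-Reasoning

  crossing-time : ∀ {ℓ w w′ φ k} → BelowLevel n ℓ w → AboveLevel n (suc ℓ) w′ →
                  w′ ≤ w + φ + 3 * k → 10 * φ < 2 * n → n < 5 * k
  crossing-time {ℓ} {w} {w′} {φ} {k} below above w′≤ 10φ<2n = *-cancelˡ-< 6 n (5 * k)
    (+-cancelˡ-< (10 * (n * ℓ)) (6 * n) (6 * (5 * k))
    (+-cancelʳ-< (4 * n) (10 * (n * ℓ) + 6 * n) (10 * (n * ℓ) + 6 * (5 * k)) (begin-strict
      10 * (n * ℓ) + 6 * n + 4 * n               ≡⟨ solve (n ∷ ℓ ∷ []) ⟩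
      10 * (n * suc ℓ)                           <⟨ above ⟩
      10 * w′ + n                                ≤⟨ +-monoˡ-≤ n (*-monoʳ-≤ 10 w′≤) ⟩
      10 * (w + φ + 3 * k) + n                   ≡⟨ solve (n ∷ w ∷ φ ∷ k ∷ []) ⟩
      10 * w + 10 * φ + (30 * k + n)             <⟨ +-monoˡ-< (30 * k + n) (+-mono-< below 10φ<2n) ⟩
      10 * (n * ℓ) + n + 2 * n + (30 * k + n)    ≡⟨ solve (n ∷ ℓ ∷ k ∷ []) ⟩
      10 * (n * ℓ) + 6 * (5 * k) + 4 * n         ∎)))
    where open ≤-Reasoning

  BelowLevel-small⇒≤ : ∀ {ℓ w} → n ≤ 4 → BelowLevel n ℓ w → w ≤ n * ℓ
  BelowLevel-small⇒≤ {ℓ} {w} n≤4 below = ≤-pred (*-cancelˡ-< 10 w (suc (n * ℓ)) (begin-strict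
    10 * w               <⟨ below ⟩
    10 * (n * ℓ) + n     ≤⟨ +-monoʳ-≤ (10 * (n * ℓ)) (≤-trans n≤4 (m≤m+n 4 6)) ⟩
    10 * (n * ℓ) + 10    ≡⟨ solve (n ∷ ℓ ∷ []) ⟩
    10 * suc (n * ℓ)     ∎))
    where open ≤-Reasoning

  ¬AboveLevel-suc-after-one-ball : ∀ {ℓ w} → 2 ≤ n → w ≤ n * ℓ → ¬ AboveLevel n (suc ℓ) (suc w)
  ¬AboveLevel-suc-after-one-ball {ℓ} {w} n≥2 w≤nℓ above = <⇒≱ 9n<10 (≤-trans (m≤m+n 10 8) (*-monoʳ-≤ 9 n≥2))
    where
    open ≤-Reasoning
    9n<10 : 9 * n < 10
    9n<10 = +-cancelʳ-< n (9 * n) 10 (+-cancelˡ-< (10 * (n * ℓ)) (9 * n + n) (10 + n) (begin-strict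
      10 * (n * ℓ) + (9 * n + n)  ≡⟨ solve (n ∷ ℓ ∷ []) ⟩
      10 * (n * suc ℓ)            <⟨ above ⟩
      10 * suc w + n              ≤⟨ +-monoˡ-≤ n (*-monoʳ-≤ 10 (s≤s w≤nℓ)) ⟩
      10 * suc (n * ℓ) + n        ≡⟨ solve (n ∷ ℓ ∷ []) ⟩
      10 * (n * ℓ) + (10 + n)     ∎))

  n<5*[1+m]⇒n≤40*m : ∀ {m} → 1 ≤ m → n < 5 * suc m → n ≤ 40 * m
  n<5*[1+m]⇒n≤40*m {m} 1≤m n<5[m+1] = begin
    n             ≤⟨ <⇒≤ n<5[m+1] ⟩
    5 * suc m     ≡⟨ solve (m ∷ []) ⟩
    5 + 5 * m     ≤⟨ +-monoˡ-≤ (5 * m) (*-monoʳ-≤ 5 1≤m) ⟩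
    5 * m + 5 * m ≡⟨ solve (m ∷ []) ⟩
    10 * m        ≤⟨ *-monoˡ-≤ m (m≤m+n 10 30) ⟩
    40 * m        ∎
    where open ≤-Reasoning

  long-side : ∀ {a q r} → a + q + r ≡ n → 5 * q < n → n ≤ 40 * a ⊎ n ≤ 40 * r
  long-side {a} {q} {r} a+q+r≡n 5q<n =
    Sum.map (n≤40*bound ≤-refl) (λ a≤r → n≤40*bound a≤r ≤-refl) (≤-total r a)
    where
    open ≤-Reasoning
    4q<a+r : 4 * q < a + r
    4q<a+r = +-cancelʳ-< q (4 * q) (a + r) (begin-strict
      4 * q + q   ≡⟨ solve (q ∷ []) ⟩
      5 * q       <⟨ 5q<n ⟩
      n           ≡⟨ a+q+r≡n ⟨
      a + q + r   ≡⟨ solve (a ∷ q ∷ r ∷ []) ⟩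
      a + r + q   ∎)
    n≤40*bound : ∀ {b} → a ≤ b → r ≤ b → n ≤ 40 * b
    n≤40*bound {b} a≤b r≤b = begin
      n                   ≡⟨ a+q+r≡n ⟨
      a + q + r           ≡⟨ solve (a ∷ q ∷ r ∷ []) ⟩
      a + r + q           ≤⟨ +-monoʳ-≤ (a + r) (≤-trans (m≤n*m q 4) (<⇒≤ 4q<a+r)) ⟩
      a + r + (a + r)     ≤⟨ +-mono-≤ a+r≤b+b a+r≤b+b ⟩
      b + b + (b + b)     ≡⟨ solve (b ∷ []) ⟩
      4 * b               ≤⟨ *-monoˡ-≤ b (m≤m+n 4 36) ⟩
      40 * b              ∎
      where
      a+r≤b+b : a + r ≤ b + b
      a+r≤b+b = +-mono-≤ a≤b r≤b

  scaled-average-bound : ∀ {a b} k .{{_ : NonZero k}} → n * a ≤ k * b → 10 * b < n * n → 10 * a < k * n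
  scaled-average-bound {a} {b} k na≤kb 10b<n² = *-cancelˡ-< n (10 * a) (k * n) (begin-strict
    n * (10 * a) ≡⟨ solve (n ∷ a ∷ []) ⟩
    10 * (n * a) ≤⟨ *-monoʳ-≤ 10 na≤kb ⟩
    10 * (k * b) ≡⟨ solve (k ∷ b ∷ []) ⟩
    k * (10 * b) <⟨ *-monoʳ-< k 10b<n² ⟩
    k * (n * n)  ≡⟨ solve (k ∷ n ∷ []) ⟩
    n * (k * n)  ∎)
    where open ≤-Reasoning

NearLevel : ∀ {n} → ℕ → Load n → Set
NearLevel {n} ℓ x = BelowLevel n ℓ (W x) × AboveLevel n ℓ (W x) × 10 * deficit ℓ x < 2 * n

closest-bin-level : ∀ {n} (x : Load n) j → (∀ i → distance x j ≤ distance x i) → ¬ Good x →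
                    NearLevel (x j) x
closest-bin-level {n} x j closest bad = below , above , deficit-small
  where
  open ≤-Reasoning
  d : Fin n → ℕ
  d = distance x
  10Σd<n² : 10 * sumFin d < n * n
  10Σd<n² = subst (λ s → 10 * s < n * n) (nΔ≡sumFin-distance x) (≰⇒> (bad ∘ inj₁))
  n*dⱼ≤1*Σd : n * d j ≤ 1 * sumFin d
  n*dⱼ≤1*Σd = ≤-trans (*-≤-sumFin closest) (m≤n*m (sumFin d) 1)
  10dⱼ<n : 10 * d j < n
  10dⱼ<n = subst (10 * d j <_) (*-identityˡ n)
    (scaled-average-bound {n} {d j} {sumFin d} 1 n*dⱼ≤1*Σd 10Σd<n²)
  nxⱼ≤W+dⱼ : n * x j ≤ W x + d j
  nxⱼ≤W+dⱼ = m≤n+∣m-n∣ (n * x j) (W x)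
  below : BelowLevel n (x j) (W x)
  below = begin-strict
    10 * W x                  ≤⟨ *-monoʳ-≤ 10 (m≤n+∣n-m∣ (W x) (n * x j)) ⟩
    10 * (n * x j + d j)      ≡⟨ *-distribˡ-+ 10 (n * x j) (d j) ⟩
    10 * (n * x j) + 10 * d j <⟨ +-monoʳ-< (10 * (n * x j)) 10dⱼ<n ⟩
    10 * (n * x j) + n        ∎
  above : AboveLevel n (x j) (W x)
  above = begin-strict
    10 * (n * x j)      ≤⟨ *-monoʳ-≤ 10 nxⱼ≤W+dⱼ ⟩
    10 * (W x + d j)    ≡⟨ *-distribˡ-+ 10 (W x) (d j) ⟩
    10 * W x + 10 * d j <⟨ +-monoʳ-< (10 * W x) 10dⱼ<n ⟩
    10 * W x + n        ∎
  nxⱼ≤nxᵢ+2dᵢ : ∀ i → n * x j ≤ n * x i + 2 * d i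
  nxⱼ≤nxᵢ+2dᵢ i = begin
    n * x j               ≤⟨ nxⱼ≤W+dⱼ ⟩
    W x + d j             ≤⟨ +-mono-≤ (m≤n+∣n-m∣ (W x) (n * x i)) (closest i) ⟩
    n * x i + d i + d i   ≡⟨ +-assoc (n * x i) (d i) (d i) ⟩
    n * x i + (d i + d i) ≡⟨ cong (λ e → n * x i + (d i + e)) (+-identityʳ (d i)) ⟨
    n * x i + 2 * d i     ∎
  deficit-term : ∀ i → n * (x j ∸ x i) ≤ 2 * d i
  deficit-term i = begin
    n * (x j ∸ x i)   ≡⟨ *-distribˡ-∸ n (x j) (x i) ⟩
    n * x j ∸ n * x i ≤⟨ m≤n+o⇒m∸n≤o (n * x j) (n * x i) (nxⱼ≤nxᵢ+2dᵢ i) ⟩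
    2 * d i           ∎
  deficit-small : 10 * deficit (x j) x < 2 * n
  deficit-small = scaled-average-bound {n} {deficit (x j) x} {sumFin d} 2 (begin
    n * deficit (x j) x            ≡⟨ *-distribˡ-sumFin n (λ i → x j ∸ x i) ⟩
    sumFin (λ i → n * (x j ∸ x i)) ≤⟨ sumFin-mono deficit-term ⟩
    sumFin (λ i → 2 * d i)         ≡⟨ *-distribˡ-sumFin 2 d ⟨
    2 * sumFin d                   ∎) 10Σd<n²

near-level : ∀ {n} (x : Load n) → ¬ Good x → ∃ λ ℓ → NearLevel ℓ x
near-level {zero}  x bad = contradiction (inj₁ z≤n) bad
near-level {suc _} x bad = x j , closest-bin-level x j closest bad
  where
  j : Fin _
  j = argmin (distance x) zero (allFin _)
  closest : ∀ i → distance x j ≤ distance x i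
  closest i = All.lookup (f[argmin]≤f[xs] {f = distance x} zero (allFin _)) (∈-allFin i)

good-between-levels : ∀ {n ℓ} (x : Load n) →
                      ¬ BelowLevel n ℓ (W x) → ¬ AboveLevel n (suc ℓ) (W x) → Good x
good-between-levels {n} {ℓ} x ¬below ¬above = decidable-stable (good? x) ¬bad
  where
  ¬bad : ¬ ¬ Good x
  ¬bad bad with ℓ′ , below′ , above′ , _ ← near-level x bad | ℓ′ ≤? ℓ
  ... | yes ℓ′≤ℓ = ¬below (BelowLevel-monoˡ {n} {w = W x} ℓ′≤ℓ below′)
  ... | no  ℓ′≰ℓ = ¬above (AboveLevel-antiˡ {n} {w = W x} (≰⇒> ℓ′≰ℓ) above′)

-- The window of rounds t₀, …, t₀ + n

suc-mono⇒mono : (f : ℕ → ℕ) → (∀ t → f t ≤ f (suc t)) → ∀ {s t} → s ≤ t → f s ≤ f t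
suc-mono⇒mono f step s≤t = go (≤⇒≤′ s≤t)
  where
  go : ∀ {s t} → s ≤′ t → f s ≤ f t
  go ≤′-refl        = ≤-refl
  go (≤′-step s≤′t) = ≤-trans (go s≤′t) (step _)

record RunEnd {p} (P : Pred ℕ p) (a b : ℕ) : Set p where
  constructor runEnd
  field
    end     : ℕ
    from    : a ≤ end
    bounded : end ≤ b
    holds   : P end
    breaks  : end < b → ¬ P (suc end)

endOfRun : ∀ {p} {P : Pred ℕ p} → Decidable P → ∀ {a b} → a ≤ b → P a → RunEnd P a b
endOfRun {P = P} P? {a} {b} a≤b Pa = subst (RunEnd P a) (m∸n+n≡m a≤b) (go (b ∸ a) Pa)
  where
  go : ∀ k {a} → P a → RunEnd P a (k + a)
  go zero    {a} Pa = runEnd a ≤-refl ≤-refl Pa (λ a<a → contradiction a<a (<-irrefl refl))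
  go (suc k) {a} Pa with P? (suc a)
  ... | no ¬Pa+1 = runEnd a ≤-refl (m≤n+m a (suc k)) Pa (λ _ → ¬Pa+1)
  ... | yes Pa+1 = runEnd end (≤-trans (n≤1+n a) from) (subst (end ≤_) (+-suc k a) bounded) holds
                          (breaks ∘ subst (end <_) (sym (+-suc k a)))
    where open RunEnd (go k Pa+1)

module _ {a p} {A : Set a} {P : Pred A p} (P? : Decidable P) where

  length-filter-∷ : ∀ x xs → length (filter P? xs) ≤ length (filter P? (x ∷ xs))
  length-filter-∷ x xs with P? x
  ... | yes _ = n≤1+n _
  ... | no  _ = ≤-refl

  block≤length-filter : (f : ℕ → A) {k : ℕ} (d m : ℕ) → d + m ≤ k →
    (∀ {i} → i < m → P (f (d + i))) → m ≤ length (filter P? (applyUpTo f k))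
  block≤length-filter f         zero    zero    _           _    = z≤n
  block≤length-filter f {suc k} zero    (suc m) (s≤s m≤k)   good with P? (f 0)
  ... | yes _   = s≤s (block≤length-filter (f ∘ suc) zero m m≤k (good ∘ s≤s))
  ... | no ¬Pf0 = contradiction (good z<s) ¬Pf0
  block≤length-filter f {suc k} (suc d) m       (s≤s d+m≤k) good =
    ≤-trans (block≤length-filter (f ∘ suc) d m d+m≤k good) (length-filter-∷ (f 0) _)

Steps : ∀ {n} .{{_ : NonZero n}} → (ℕ → Load n) → Set
Steps y = ∀ t → ∃ λ i → W₁-step (y t) i (y (suc t))

module _ {n} .{{_ : NonZero n}} {y : ℕ → Load n} (steps : Steps y) where

  step : ∀ t → W₁-step (y t) (proj₁ (steps t)) (y (suc t))
  step t = proj₂ (steps t)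

  W-grows-by : ∀ s k → W (y s) + k ≤ W (y (k + s))
  W-grows-by s zero    = ≤-reflexive (+-identityʳ (W (y s)))
  W-grows-by s (suc k) = begin
    W (y s) + suc k     ≡⟨ +-suc (W (y s)) k ⟩
    suc (W (y s) + k)   ≤⟨ s≤s (W-grows-by s k) ⟩
    suc (W (y (k + s))) ≤⟨ W₁-step-W< (step (k + s)) ⟩
    W (y (suc k + s))   ∎
    where open ≤-Reasoning

  W-grows : ∀ {s t} → s ≤ t → W (y s) + (t ∸ s) ≤ W (y t)
  W-grows {s} {t} s≤t = subst (λ u → W (y s) + (t ∸ s) ≤ W (y u)) (m∸n+n≡m s≤t) (W-grows-by s (t ∸ s))

  W-mono : ∀ {s t} → s ≤ t → W (y s) ≤ W (y t)
  W-mono s≤t = ≤-trans (m≤m+n _ _) (W-grows s≤t)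

  deficit-anti : ∀ ℓ {s t} → s ≤ t → deficit ℓ (y t) ≤ deficit ℓ (y s)
  deficit-anti ℓ s≤t = sumFin-mono λ j →
    ∸-monoʳ-≤ ℓ (suc-mono⇒mono (λ t → y t j) (λ t → W₁-step-load-mono (step t) j) s≤t)

  potential-drift : ∀ ℓ p k → (∀ {j} → j < k → W (y (j + p)) ≤ n * suc ℓ) →
                    potential ℓ (y (k + p)) ≤ potential ℓ (y p) + 3 * k
  potential-drift ℓ p zero    _       = ≤-reflexive (sym (+-identityʳ _))
  potential-drift ℓ p (suc k) bounded = begin
    potential ℓ (y (suc k + p))     ≤⟨ W₁-step-potential (step (k + p)) (bounded (n<1+n k)) ⟩
    potential ℓ (y (k + p)) + 3     ≤⟨ +-monoˡ-≤ 3 (potential-drift ℓ p k (bounded ∘ m<n⇒m<1+n)) ⟩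
    potential ℓ (y p) + 3 * k + 3   ≡⟨ +-assoc (potential ℓ (y p)) (3 * k) 3 ⟩
    potential ℓ (y p) + (3 * k + 3) ≡⟨ cong (potential ℓ (y p) +_) (solve (k ∷ [])) ⟩
    potential ℓ (y p) + 3 * suc k   ∎
    where open ≤-Reasoning

module Window {n} .{{_ : NonZero n}} (n≥2 : 2 ≤ n) {y : ℕ → Load n} (steps : Steps y) where

  GoodBlock : ℕ → ℕ → Set
  GoodBlock d m = ∀ {i} → i < m → Good (y (d + i))

  record LongGoodBlock : Set where
    constructor block
    field
      start size : ℕ
      within     : start + size ≤ suc n
      long       : n ≤ 40 * size
      good       : GoodBlock start size

  extend-block : ∀ {d m} → GoodBlock d m → Good (y (d + m)) → GoodBlock d (suc m)
  extend-block good good-end i<m+1 with m<1+n⇒m<n∨m≡n i<m+1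
  ... | inj₁ i<m  = good i<m
  ... | inj₂ refl = good-end

  Below Above : ℕ → ℕ → Set
  Below ℓ t = BelowLevel n ℓ (W (y t))
  Above ℓ t = AboveLevel n ℓ (W (y t))

  below? : ∀ ℓ → Decidable (Below ℓ)
  below? ℓ t = 10 * W (y t) <? 10 * (n * ℓ) + n

  above? : ∀ ℓ → Decidable (Above ℓ)
  above? ℓ t = 10 * (n * ℓ) <? 10 * W (y t) + n

  ¬Below-mono : ∀ {ℓ s t} → s ≤ t → ¬ Below ℓ s → ¬ Below ℓ t
  ¬Below-mono {ℓ} {s} {t} s≤t ¬below-s below-t =
    ¬below-s (BelowLevel-antiʳ {n} {ℓ} {W (y s)} {W (y t)} (W-mono steps s≤t) below-t)

  ¬Above-anti : ∀ {ℓ s t} → s ≤ t → ¬ Above ℓ t → ¬ Above ℓ s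
  ¬Above-anti {ℓ} {s} {t} s≤t ¬above-t above-s =
    ¬above-t (AboveLevel-monoʳ {n} {ℓ} {W (y s)} {W (y t)} (W-mono steps s≤t) above-s)

  module FromBadRound {a ℓ} (a≤n : a ≤ n) (before : GoodBlock 0 a) (belowₐ : Below ℓ a)
                      (aboveₐ : Above ℓ a) (deficitₐ : 10 * deficit ℓ (y a) < 2 * n) where

    open RunEnd (endOfRun (below? ℓ) a≤n belowₐ)
      renaming (end to p; from to a≤p; bounded to p≤n; holds to belowₚ; breaks to leaves-below)

    deficitₚ : 10 * deficit ℓ (y p) < 2 * n
    deficitₚ = ≤-<-trans (*-monoʳ-≤ 10 (deficit-anti steps ℓ a≤p)) deficitₐ

    -- For n ≤ 4 the potential bound allows crossing the gap in one round; but then the deficit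
    -- vanishes, so with W ≤ nℓ no bin is below average and that round adds a single ball.
    no-crossing-in-one-round : n ≤ 4 → ¬ Above (suc ℓ) (suc p)
    no-crossing-in-one-round n≤4 above-p+1 = ¬AboveLevel-suc-after-one-ball {n} n≥2 Wₚ≤nℓ
      (subst (AboveLevel n (suc ℓ)) W-after-p above-p+1)
      where
      Wₚ≤nℓ : W (y p) ≤ n * ℓ
      Wₚ≤nℓ = BelowLevel-small⇒≤ {n} n≤4 belowₚ
      deficitₚ≡0 : deficit ℓ (y p) ≡ 0
      deficitₚ≡0 = n<1⇒n≡0 (*-cancelˡ-< 10 (deficit ℓ (y p)) 1
        (<-≤-trans deficitₚ (≤-trans (*-monoʳ-≤ 2 n≤4) (m≤m+n 8 2))))
      W-after-p : W (y (suc p)) ≡ suc (W (y p))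
      W-after-p = W₁-step-balanced (step steps p) (deficit≡0⇒level≤ (y p) deficitₚ≡0) Wₚ≤nℓ

    between-block : ∀ {c} → p ≤ c → c ≤ n → ¬ Above (suc ℓ) c → GoodBlock (suc p) (c ∸ p)
    between-block {c} p≤c c≤n ¬above-c {i} i<c∸p = good-between-levels (y (suc p + i))
      (¬Below-mono p+1≤t (leaves-below (<-≤-trans p+1≤t (≤-trans t≤c c≤n))))
      (¬Above-anti t≤c ¬above-c)
      where
      open ≤-Reasoning
      p+1≤t : suc p ≤ suc p + i
      p+1≤t = m≤m+n (suc p) i
      t≤c : suc p + i ≤ c
      t≤c = begin
        suc p + i   ≡⟨ +-suc p i ⟨
        p + suc i   ≤⟨ +-monoʳ-≤ p i<c∸p ⟩
        p + (c ∸ p) ≡⟨ m+[n∸m]≡n p≤c ⟩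
        c           ∎

    never-above-next-level : ¬ Above (suc ℓ) n → LongGoodBlock
    never-above-next-level ¬above-n =
      Sum.[ before-a , after-p ] (long-side {n} {a} {p ∸ a} {n ∸ p} a+[p∸a]+[n∸p]≡n p-near-a)
      where
      a+[p∸a]+[n∸p]≡n : a + (p ∸ a) + (n ∸ p) ≡ n
      a+[p∸a]+[n∸p]≡n = trans (cong (_+ (n ∸ p)) (m+[n∸m]≡n a≤p)) (m+[n∸m]≡n p≤n)
      p-near-a : 5 * (p ∸ a) < n
      p-near-a = band-width {n} {ℓ} {W (y a)} {p ∸ a} aboveₐ
        (BelowLevel-antiʳ {n} {ℓ} {W (y a) + (p ∸ a)} {W (y p)} (W-grows steps a≤p) belowₚ)
      before-a : n ≤ 40 * a → LongGoodBlock
      before-a long = block 0 a (≤-trans a≤n (n≤1+n n)) long before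
      after-p : n ≤ 40 * (n ∸ p) → LongGoodBlock
      after-p long = block (suc p) (n ∸ p) (s≤s (≤-reflexive (m+[n∸m]≡n p≤n))) long
                           (between-block p≤n ≤-refl ¬above-n)

    module ReachesNextLevel (above-n : Above (suc ℓ) n) where

      open RunEnd (endOfRun (¬? ∘ above? (suc ℓ)) p≤n (BelowLevel⇒¬AboveLevel-suc {n} {w = W (y p)} belowₚ))
        renaming (end to c; from to p≤c; bounded to c≤n; holds to ¬above-c; breaks to leaves-not-above)

      above-c+1 : Above (suc ℓ) (suc c)
      above-c+1 = decidable-stable (above? (suc ℓ) (suc c))
        (leaves-not-above (≤∧≢⇒< c≤n (λ c≡n → ¬above-c (subst (Above (suc ℓ)) (sym c≡n) above-n))))

      bounded-until-c : ∀ {j} → j < suc (c ∸ p) → W (y (j + p)) ≤ n * suc ℓ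
      bounded-until-c {j} j<gap+1 = ¬AboveLevel-suc⇒≤ {n} (¬Above-anti j+p≤c ¬above-c)
        where
        j+p≤c : j + p ≤ c
        j+p≤c = ≤-trans (+-monoˡ-≤ p (≤-pred j<gap+1)) (≤-reflexive (m∸n+n≡m p≤c))

      drift : W (y (suc c)) ≤ W (y p) + deficit ℓ (y p) + 3 * suc (c ∸ p)
      drift = begin
        W (y (suc c))                               ≤⟨ W≤potential ℓ (y (suc c)) ⟩
        potential ℓ (y (suc c))                     ≡⟨ cong (potential ℓ ∘ y ∘ suc) (m∸n+n≡m p≤c) ⟨
        potential ℓ (y (suc (c ∸ p) + p))           ≤⟨ potential-drift steps ℓ p (suc (c ∸ p)) bounded-until-c ⟩
        potential ℓ (y p) + 3 * suc (c ∸ p)         ≡⟨ cong (_+ 3 * suc (c ∸ p)) (potential≡W+deficit ℓ (y p)) ⟩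
        W (y p) + deficit ℓ (y p) + 3 * suc (c ∸ p) ∎
        where open ≤-Reasoning

      n<5*[1+gap] : n < 5 * suc (c ∸ p)
      n<5*[1+gap] = crossing-time {n} {w′ = W (y (suc c))} {φ = deficit ℓ (y p)} {k = suc (c ∸ p)}
                      belowₚ above-c+1 drift deficitₚ

      gap≢0 : c ∸ p ≢ 0
      gap≢0 gap≡0 = Sum.[ small , large ] (≤-<-connex n 4)
        where
        small : n ≤ 4 → ⊥
        small n≤4 = no-crossing-in-one-round n≤4
          (subst (Above (suc ℓ) ∘ suc) (trans (sym (m∸n+n≡m p≤c)) (cong (_+ p) gap≡0)) above-c+1)
        large : 4 < n → ⊥
        large 4<n = <⇒≱ (subst (λ m → n < 5 * suc m) gap≡0 n<5*[1+gap]) 4<n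

      long-block : LongGoodBlock
      long-block = block (suc p) (c ∸ p) (s≤s (≤-trans (≤-reflexive (m+[n∸m]≡n p≤c)) c≤n))
        (n<5*[1+m]⇒n≤40*m {n} (n≢0⇒n>0 gap≢0) n<5*[1+gap]) (between-block p≤c c≤n ¬above-c)

    long-block : LongGoodBlock
    long-block = decide (above? (suc ℓ) n)
      where
      decide : Dec (Above (suc ℓ) n) → LongGoodBlock
      decide (yes above-n) = ReachesNextLevel.long-block above-n
      decide (no ¬above-n) = never-above-next-level ¬above-n

  long-good-block : LongGoodBlock
  long-good-block = from-good-prefix (endOfRun (allUpTo? (good? ∘ y)) (z≤n {suc n}) (λ ()))
    where
    from-good-prefix : RunEnd (GoodBlock 0) 0 (suc n) → LongGoodBlock
    from-good-prefix (runEnd a _ a≤n+1 before stops) = Sum.[ first-bad , all-good ] (m≤n⇒m<n∨m≡n a≤n+1)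
      where
      all-good : a ≡ suc n → LongGoodBlock
      all-good refl = block 0 (suc n) ≤-refl (≤-trans (n≤1+n n) (m≤n*m (suc n) 40)) before
      from-level : ∃ (λ ℓ → NearLevel ℓ (y a)) → a ≤ n → LongGoodBlock
      from-level (ℓ , belowₐ , aboveₐ , deficitₐ) a≤n =
        FromBadRound.long-block a≤n before belowₐ aboveₐ deficitₐ
      first-bad : a < suc n → LongGoodBlock
      first-bad a<n+1 = from-level (near-level (y a) (stops a<n+1 ∘ extend-block before)) (≤-pred a<n+1)

-- The
-- window is re-indexed as i ↦ x (i + t₀) so that suc i + t₀ is definitionally suc (i + t₀).
mainTheorem12 : (n : ℕ) .{{_ : NonZero n}} → 2 ≤ n →
    (x : ℕ → Load n) → IsRun x →
    (t₀ : ℕ) → 1 ≤ t₀ → n ≤ 40 * countGood x t₀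
mainTheorem12 n n≥2 x (_ , steps) t₀ _ = ≤-trans long (*-monoʳ-≤ 40 size≤count)
  where
  open Window.LongGoodBlock (Window.long-good-block n≥2 {λ t → x (t + t₀)} (λ t → steps (t + t₀)))
  size≤count : size ≤ countGood x t₀
  size≤count = subst (λ l → size ≤ length (filter (good? ∘ x) l)) (sym (map-upTo (t₀ +_) (suc n)))
    (block≤length-filter (good? ∘ x) (t₀ +_) start size within
      (λ {i} i<size → subst (Good ∘ x) (+-comm (start + i) t₀) (good i<size)))
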